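{- Let $G=(V,E)$ be a simple undirected graph with no isolated vertices, with a split partition $(K,I)$ (i.e. $V=K\cup I$ disjointly, $K$ a clique, $I$ an independent set) such that every vertex of $K$ has at least one neighbor in $I$. If $G$ is equimatchable, then there do not exist six distinct vertices $k_1,k_2,k_3\in K$ and $i_1,i_2,i_3\in I$ with $k_1i_1,k_2i_2,k_3i_3\in E$.
   Context: A matching is a set of pairwise vertex-disjoint edges; it is maximal if it is not properly contained in another matching. A graph is equimatchable if all its maximal matchings have the same number of edges. A vertex is isolated if it has no neighbors. -}

module Defs where

open import Data.Nat using (ℕ)
open import Data.Fin using (Fin)
open import Data.Bool using (Bool; true; false)
open import Data.Product using (_×_; _,_; proj₁; proj₂; Σ; ∃)
open import Data.Sum using (_⊎_)
open import Data.List using (List; length; concatMap; _∷_; [])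
open import Data.List.Membership.Propositional using (_∈_)
open import Data.List.Relation.Unary.All using (All)
open import Data.List.Relation.Unary.Unique.Propositional using (Unique)
open import Relation.Binary.PropositionalEquality using (_≡_)
open import Relation.Nullary using (¬_)
open import Level using (0ℓ)

record Graph (n : ℕ) : Set₁ where
  field
    Adj     : Fin n → Fin n → Set
    sym     : ∀ {u v} → Adj u v → Adj v u
    irrefl  : ∀ {v} → ¬ Adj v v

module _ {n : ℕ} (G : Graph n) where
  open Graph G

  NoIsolated : Set
  NoIsolated = ∀ v → ∃ λ u → Adj v u

  -- An edge is represented by an (ordered) pair of adjacent vertices;
  -- a matching is a list of such pairs.
  Edge : Set
  Edge = Fin n × Fin n

  endpoints : List Edge → List (Fin n)
  endpoints = concatMap (λ e → proj₁ e ∷ proj₂ e ∷ [])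

  -- A matching: every listed pair is an edge of G, and the edges are
  -- pairwise vertex-disjoint (all endpoints, listed with multiplicity, distinct).
  IsMatching : List Edge → Set
  IsMatching M = All (λ e → Adj (proj₁ e) (proj₂ e)) M × Unique (endpoints M)

  _∈ₑ_ : Edge → List Edge → Set
  (u , v) ∈ₑ M = ((u , v) ∈ M) ⊎ ((v , u) ∈ M)

  _⊆ₑ_ : List Edge → List Edge → Set
  M ⊆ₑ M' = ∀ e → e ∈ M → e ∈ₑ M'

  _⊂ₑ_ : List Edge → List Edge → Set
  M ⊂ₑ M' = (M ⊆ₑ M') × (∃ λ e → (e ∈ M') × ¬ (e ∈ₑ M))

  IsMaximalMatching : List Edge → Set
  IsMaximalMatching M = IsMatching M × (∀ M' → IsMatching M' → ¬ (M ⊂ₑ M'))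

  Equimatchable : Set
  Equimatchable = ∀ M M' → IsMaximalMatching M → IsMaximalMatching M' →
                  length M ≡ length M'

  -- split partition (K, I) given by a Boolean labelling:
  -- inK v ≡ true means v ∈ K, inK v ≡ false means v ∈ I.
  -- K is a clique and I is an independent set.
  IsSplitPartition : (Fin n → Bool) → Set
  IsSplitPartition inK =
    (∀ u v → inK u ≡ true → inK v ≡ true → ¬ u ≡ v → Adj u v) ×
    (∀ u v → inK u ≡ false → inK v ≡ false → ¬ Adj u v)

module Submission where

-- Suppose k₁i₁, k₂i₂, k₃i₃ are three
-- vertex-disjoint K–I edges.  Extend B = {k₁i₁, k₂i₂, k₃i₃} to a maximal
-- matching M = Y ∪ B, and replace the three edges of B by the two edges
-- k₁k₂ and k₃z, where z is a K-vertex left unmatched by M if one exists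
-- (there is at most one, since K is a clique and M is maximal) and z = i₃
-- otherwise.  Every vertex left unmatched by the new matching M′ lies in
-- the independent set I, so M′ is maximal as well; but |M′| = |M| - 1,
-- contradicting equimatchability.

open import Defs
open import Data.Nat using (ℕ; zero; suc; _≤_; _+_)
open import Data.Nat.Properties
  using (≤-trans; +-suc; +-identityʳ; n≤1+n; m≤n+m; 1+n≰n; +-cancelˡ-≡)
open import Data.Fin using (Fin; zero; suc; _≟_)
open import Data.Fin.Properties using (injective⇒≤; any?)
open import Data.Bool using (Bool; true; false)
import Data.Bool as Bool
open import Data.Product using (_×_; ∃; ∃₂; _,_; proj₁; proj₂)
open import Data.Sum using (_⊎_; inj₁; inj₂; [_,_])
open import Data.Empty using (⊥; ⊥-elim)
open import Data.Vec using (_∷_; [])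
import Data.Vec.Relation.Unary.Unique.Propositional as Vec
open import Data.Vec.Relation.Unary.All using (_∷_; [])
open import Data.Vec.Relation.Unary.AllPairs using (_∷_; [])
open import Data.List using (List; length; lookup; _++_; _∷_; [])
open import Data.List.Properties using (concatMap-++; length-++)
open import Data.List.Relation.Unary.All using (All; _∷_; [])
import Data.List.Relation.Unary.All as All
import Data.List.Relation.Unary.All.Properties as All
open import Data.List.Relation.Unary.AllPairs using (_∷_; [])
import Data.List.Relation.Unary.Any as Any
open import Data.List.Relation.Unary.Any using (here; there)
open import Data.List.Relation.Unary.Unique.Propositional using (Unique)
import Data.List.Relation.Unary.Unique.Propositional.Properties as Unique
open import Data.List.Relation.Binary.Disjoint.Propositional using (Disjoint)
open import Data.List.Membership.Propositional using (_∈_; _∉_; find)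
open import Data.List.Membership.Propositional.Properties
  using (∈-++⁺ˡ; ∈-++⁺ʳ; ∈-++⁻; ∈-lookup; ∈-concatMap⁺; ∈-concatMap⁻)
open import Function.Definitions using (Injective)
open import Relation.Binary.PropositionalEquality
  using (_≡_; _≢_; ≢-sym; refl; sym; trans; subst)
open import Relation.Nullary using (¬_; yes; no; ¬?; _×-dec_)
open import Relation.Nullary.Decidable using (¬¬-excluded-middle)

Unique-++⁻ : ∀ {A : Set} (xs : List A) {ys : List A} → Unique (xs ++ ys) →
             Unique xs × Unique ys × Disjoint xs ys
Unique-++⁻ [] u = [] , u , λ ()
Unique-++⁻ (x ∷ xs) (x∉ ∷ u) with Unique-++⁻ xs u
... | uxs , uys , xs#ys = (All.++⁻ˡ xs x∉ ∷ uxs) , uys , disjoint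
  where
  disjoint : Disjoint (x ∷ xs) _
  disjoint (here refl , y∈ys) = All.lookup x∉ (∈-++⁺ʳ xs y∈ys) refl
  disjoint (there y∈xs , y∈ys) = xs#ys (y∈xs , y∈ys)

lookup-injective : ∀ {A : Set} {xs : List A} → Unique xs →
                   Injective _≡_ _≡_ (lookup xs)
lookup-injective (x∉ ∷ u) {zero}  {zero}  eq = refl
lookup-injective (x∉ ∷ u) {zero}  {suc j} eq = ⊥-elim (All.lookup x∉ (∈-lookup j) eq)
lookup-injective (x∉ ∷ u) {suc i} {zero}  eq = ⊥-elim (All.lookup x∉ (∈-lookup i) (sym eq))
lookup-injective (x∉ ∷ u) {suc i} {suc j} eq with lookup-injective u eq
... | refl = refl

unique-length≤ : ∀ {n} {xs : List (Fin n)} → Unique xs → length xs ≤ n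
unique-length≤ u = injective⇒≤ (lookup-injective u)

interleave-unique : ∀ {A : Set} {a b c d e f : A} →
                    Vec.Unique (a ∷ b ∷ c ∷ d ∷ e ∷ f ∷ []) →
                    Unique (a ∷ d ∷ b ∷ e ∷ c ∷ f ∷ [])
interleave-unique
  ((a≢b ∷ a≢c ∷ a≢d ∷ a≢e ∷ a≢f ∷ []) ∷ (b≢c ∷ b≢d ∷ b≢e ∷ b≢f ∷ []) ∷
   (c≢d ∷ c≢e ∷ c≢f ∷ []) ∷ (d≢e ∷ d≢f ∷ []) ∷ (e≢f ∷ []) ∷ [] ∷ []) =
  (a≢d ∷ a≢b ∷ a≢e ∷ a≢c ∷ a≢f ∷ []) ∷
  (≢-sym b≢d ∷ d≢e ∷ ≢-sym c≢d ∷ d≢f ∷ []) ∷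
  (b≢e ∷ b≢c ∷ b≢f ∷ []) ∷
  (≢-sym c≢e ∷ e≢f ∷ []) ∷
  (c≢f ∷ []) ∷ [] ∷ []

module Matchings {n : ℕ} (G : Graph n) where
  open Graph G using (Adj; irrefl)
  open import Data.List.Membership.DecPropositional (_≟_ {n}) using (_∈?_)

  endsOf : Edge G → List (Fin n)
  endsOf e = proj₁ e ∷ proj₂ e ∷ []

  ends : List (Edge G) → List (Fin n)
  ends = endpoints G

  ∈-ends⁺ : ∀ {x e M} → e ∈ M → x ∈ endsOf e → x ∈ ends M
  ∈-ends⁺ e∈M x∈e = ∈-concatMap⁺ endsOf (Any.map (λ { refl → x∈e }) e∈M)

  ∈-ends⁻ : ∀ {x} M → x ∈ ends M → ∃ λ e → e ∈ M × x ∈ endsOf e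
  ∈-ends⁻ M x∈M = find (∈-concatMap⁻ endsOf {xs = M} x∈M)

  ends-++ : ∀ M N → ends (M ++ N) ≡ ends M ++ ends N
  ends-++ = concatMap-++ endsOf

  ∈-ends-++⁺ : ∀ {x} M {N} → x ∈ ends M ⊎ x ∈ ends N → x ∈ ends (M ++ N)
  ∈-ends-++⁺ M {N} x∈ =
    subst (_ ∈_) (sym (ends-++ M N)) ([ ∈-++⁺ˡ , ∈-++⁺ʳ (ends M) ] x∈)

  ∈-ends-++⁻ : ∀ {x} M {N} → x ∈ ends (M ++ N) → x ∈ ends M ⊎ x ∈ ends N
  ∈-ends-++⁻ M {N} x∈ = ∈-++⁻ (ends M) (subst (_ ∈_) (ends-++ M N) x∈)

  flip-endpoint : ∀ {x} {e : Edge G} → x ∈ endsOf e → x ∈ endsOf (proj₂ e , proj₁ e)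
  flip-endpoint (here x≡u) = there (here x≡u)
  flip-endpoint (there (here x≡v)) = here x≡v

  shared-endpoint⇒same : ∀ {x e g} M → Unique (ends M) → e ∈ M → g ∈ M →
                         x ∈ endsOf e → x ∈ endsOf g → e ≡ g
  shared-endpoint⇒same (a ∷ M) u (here refl) (here refl) _ _ = refl
  shared-endpoint⇒same (a ∷ M) u (here refl) (there g∈M) x∈a x∈g =
    ⊥-elim (proj₂ (proj₂ (Unique-++⁻ (endsOf a) u)) (x∈a , ∈-ends⁺ g∈M x∈g))
  shared-endpoint⇒same (a ∷ M) u (there e∈M) (here refl) x∈e x∈a =
    ⊥-elim (proj₂ (proj₂ (Unique-++⁻ (endsOf a) u)) (x∈a , ∈-ends⁺ e∈M x∈e))
  shared-endpoint⇒same (a ∷ M) u (there e∈M) (there g∈M) x∈e x∈g =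
    shared-endpoint⇒same M (proj₁ (proj₂ (Unique-++⁻ (endsOf a) u))) e∈M g∈M x∈e x∈g

  Dominating : List (Edge G) → Set
  Dominating M = ∀ u v → Adj u v → u ∈ ends M ⊎ v ∈ ends M

  -- A dominating matching is maximal: an edge of a larger matching that is
  -- missing from M would share a matched endpoint with an edge of M.
  dominating⇒maximal : ∀ M → IsMatching G M → Dominating M → IsMaximalMatching G M
  dominating⇒maximal M matchingM dominatingM = matchingM , no-proper-extension
    where
    no-proper-extension : ∀ M′ → IsMatching G M′ → ¬ (_⊂ₑ_ G M M′)
    no-proper-extension M′ (adjacent′ , unique′) (M⊆M′ , (u , v) , uv∈M′ , uv∉M) =
      [ blocked (here refl) , blocked (there (here refl)) ]
        (dominatingM u v (All.lookup adjacent′ uv∈M′))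
      where
      blocked : ∀ {x} → x ∈ endsOf (u , v) → x ∉ ends M
      blocked x∈uv x∈M with ∈-ends⁻ M x∈M
      ... | f , f∈M , x∈f with M⊆M′ f f∈M
      ...   | inj₁ f∈M′ with shared-endpoint⇒same M′ unique′ uv∈M′ f∈M′ x∈uv x∈f
      ...     | refl = uv∉M (inj₁ f∈M)
      blocked x∈uv x∈M | f , f∈M , x∈f | inj₂ f˘∈M′
        with shared-endpoint⇒same M′ unique′ uv∈M′ f˘∈M′ x∈uv (flip-endpoint x∈f)
      ...     | refl = uv∉M (inj₂ f∈M)

  unmatched-nonadjacent : ∀ M {x y} → Dominating M → x ∉ ends M → y ∉ ends M → ¬ Adj x y
  unmatched-nonadjacent M dominatingM x∉M y∉M xy = [ x∉M , y∉M ] (dominatingM _ _ xy)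

  FreeEdge : List (Edge G) → Set
  FreeEdge M = ∃₂ λ u v → Adj u v × u ∉ ends M × v ∉ ends M

  -- Matched vertices are decidable, so a matching without free edges is dominating.
  no-free-edge⇒dominating : ∀ M → ¬ FreeEdge M → Dominating M
  no-free-edge⇒dominating M noFree u v uv with u ∈? ends M | v ∈? ends M
  ... | yes u∈M | _       = inj₁ u∈M
  ... | no _    | yes v∈M = inj₂ v∈M
  ... | no u∉M  | no v∉M  = ⊥-elim (noFree (u , v , uv , u∉M , v∉M))

  unmatched-independent⇒dominating : ∀ (P : Fin n → Set) → (∀ u v → P u → P v → ¬ Adj u v) →
                                     ∀ M → (∀ x → x ∉ ends M → P x) → Dominating M
  unmatched-independent⇒dominating P independent M unmatched⇒P =
    no-free-edge⇒dominating M λ (u , v , uv , u∉M , v∉M) →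
      independent u v (unmatched⇒P u u∉M) (unmatched⇒P v v∉M) uv

  add-edge : ∀ {u v M} → Adj u v → u ∉ ends M → v ∉ ends M → IsMatching G M →
             IsMatching G ((u , v) ∷ M)
  add-edge {u} {v} {M} uv u∉M v∉M (adjacent , unique) =
    uv ∷ adjacent ,
    (u≢v ∷ All.¬Any⇒All¬ (ends M) u∉M) ∷ (All.¬Any⇒All¬ (ends M) v∉M ∷ unique)
    where
    u≢v : u ≢ v
    u≢v refl = irrefl uv

  -- Every matching B extends to a dominating matching Y ++ B.  Adjacency is
  -- not decidable, so this holds up to double negation; termination uses
  -- that a matching matches at most n vertices.
  extend-to-dominating : ∀ B → IsMatching G B →
                         ¬ ¬ (∃ λ Y → IsMatching G (Y ++ B) × Dominating (Y ++ B))
  extend-to-dominating B matchingB = grow n [] matchingB (m≤n+m n _)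
    where
    Extension : Set
    Extension = ∃ λ Y → IsMatching G (Y ++ B) × Dominating (Y ++ B)

    -- invariant: n ≤ (number of matched vertices) + fuel; each added edge
    -- matches two new vertices and consumes one unit of fuel
    grow : ∀ fuel Y → IsMatching G (Y ++ B) → n ≤ length (ends (Y ++ B)) + fuel →
           ¬ ¬ Extension
    add-and-grow : ∀ fuel Y {u v} → IsMatching G ((u , v) ∷ Y ++ B) →
                   n ≤ length (ends (Y ++ B)) + fuel → ¬ ¬ Extension

    grow fuel Y matchingY bound noExtension = ¬¬-excluded-middle λ where
      (no noFree) → noExtension (Y , matchingY , no-free-edge⇒dominating (Y ++ B) noFree)
      (yes (u , v , uv , u∉ , v∉)) →
        add-and-grow fuel Y (add-edge uv u∉ v∉ matchingY) bound noExtension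

    -- with no fuel left, the grown matching would match more than n vertices
    add-and-grow zero Y grown bound _ =
      1+n≰n (≤-trans (n≤1+n _) (≤-trans (unique-length≤ (proj₂ grown))
                                        (subst (n ≤_) (+-identityʳ _) bound)))
    add-and-grow (suc fuel) Y grown bound =
      grow fuel (_ ∷ Y) grown (≤-trans (subst (n ≤_) (+-suc _ fuel) bound) (n≤1+n _))

  exchange : ∀ Y B C → IsMatching G (Y ++ B) → All (λ e → Adj (proj₁ e) (proj₂ e)) C →
             Unique (ends C) → Disjoint (ends Y) (ends C) → IsMatching G (Y ++ C)
  exchange Y B C (adjacent , unique) adjacentC uniqueC fresh =
    All.++⁺ (All.++⁻ˡ Y adjacent) adjacentC ,
    subst Unique (sym (ends-++ Y C))
      (Unique.++⁺ (proj₁ (Unique-++⁻ (ends Y) (subst Unique (ends-++ Y B) unique))) uniqueC fresh)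

module Swap {n : ℕ} (G : Graph n) (inK : Fin n → Bool)
  (clique : ∀ u v → inK u ≡ true → inK v ≡ true → u ≢ v → Graph.Adj G u v)
  (independent : ∀ u v → inK u ≡ false → inK v ≡ false → ¬ Graph.Adj G u v)
  (equimatchable : Equimatchable G)
  {k₁ k₂ k₃ i₁ i₂ i₃ : Fin n}
  (k₁∈K : inK k₁ ≡ true) (k₂∈K : inK k₂ ≡ true) (k₃∈K : inK k₃ ≡ true)
  (i₁∈I : inK i₁ ≡ false) (i₂∈I : inK i₂ ≡ false) (i₃∈I : inK i₃ ≡ false)
  (k₃i₃ : Graph.Adj G k₃ i₃)
  (Y : List (Edge G))
  (matchingM : IsMatching G (Y ++ (k₁ , i₁) ∷ (k₂ , i₂) ∷ (k₃ , i₃) ∷ []))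
  (dominatingM : Matchings.Dominating G (Y ++ (k₁ , i₁) ∷ (k₂ , i₂) ∷ (k₃ , i₃) ∷ []))
  where
  open Graph G using (Adj)
  open Matchings G
  open import Data.List.Membership.DecPropositional (_≟_ {n}) using (_∈?_)

  B : List (Edge G)
  B = (k₁ , i₁) ∷ (k₂ , i₂) ∷ (k₃ , i₃) ∷ []

  M : List (Edge G)
  M = Y ++ B

  splitM : Unique (ends Y) × Unique (ends B) × Disjoint (ends Y) (ends B)
  splitM = Unique-++⁻ (ends Y) (subst Unique (ends-++ Y B) (proj₂ matchingM))

  distinct : (k₁ ≢ k₂ × k₁ ≢ k₃ × k₂ ≢ k₃) × (k₁ ≢ i₃ × k₂ ≢ i₃ × k₃ ≢ i₃)
  distinct with proj₁ (proj₂ splitM)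
  ... | (_ ∷ k₁≢k₂ ∷ _ ∷ k₁≢k₃ ∷ k₁≢i₃ ∷ []) ∷ _ ∷ (_ ∷ k₂≢k₃ ∷ k₂≢i₃ ∷ []) ∷ _ ∷ (k₃≢i₃ ∷ []) ∷ _ =
    (k₁≢k₂ , k₁≢k₃ , k₂≢k₃) , (k₁≢i₃ , k₂≢i₃ , k₃≢i₃)

  k₁≢k₂ : k₁ ≢ k₂
  k₁≢k₂ = proj₁ (proj₁ distinct)

  k₁≢k₃ : k₁ ≢ k₃
  k₁≢k₃ = proj₁ (proj₂ (proj₁ distinct))

  k₂≢k₃ : k₂ ≢ k₃
  k₂≢k₃ = proj₂ (proj₂ (proj₁ distinct))

  k₁≢i₃ : k₁ ≢ i₃
  k₁≢i₃ = proj₁ (proj₂ distinct)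

  k₂≢i₃ : k₂ ≢ i₃
  k₂≢i₃ = proj₁ (proj₂ (proj₂ distinct))

  k₃≢i₃ : k₃ ≢ i₃
  k₃≢i₃ = proj₂ (proj₂ (proj₂ distinct))

  k₁∈B : k₁ ∈ ends B
  k₁∈B = here refl

  k₂∈B : k₂ ∈ ends B
  k₂∈B = there (there (here refl))

  k₃∈B : k₃ ∈ ends B
  k₃∈B = there (there (there (there (here refl))))

  i₃∈B : i₃ ∈ ends B
  i₃∈B = there (there (there (there (there (here refl)))))

  B-matched : ∀ {x} → x ∈ ends B → x ∈ ends M
  B-matched x∈B = ∈-ends-++⁺ Y (inj₂ x∈B)

  B-not-in-Y : ∀ {x} → x ∈ ends B → x ∉ ends Y
  B-not-in-Y x∈B x∈Y = proj₂ (proj₂ splitM) (x∈Y , x∈B)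

  K-disjoint-I : ∀ {x} → inK x ≡ true → inK x ≡ false → ⊥
  K-disjoint-I x∈K x∈I with trans (sym x∈K) x∈I
  ... | ()

  M′ : Fin n → List (Edge G)
  M′ z = Y ++ (k₁ , k₂) ∷ (k₃ , z) ∷ []

  -- If k₃z is an edge on a vertex z outside Y and outside {k₁,k₂,k₃}, and z
  -- is the only K-vertex that M may leave unmatched, then M′ z is a maximal
  -- matching smaller than M.
  swap-contradiction : ∀ z → Adj k₃ z → z ∉ ends Y → k₁ ≢ z → k₂ ≢ z → k₃ ≢ z →
                       (∀ x → inK x ≡ true → x ∉ ends M → x ≡ z) → ⊥
  swap-contradiction z k₃z z∉Y k₁≢z k₂≢z k₃≢z unmatched-K = 3≢2 (+-cancelˡ-≡ (length Y) 3 2 sizes)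
    where
    newEnds : List (Fin n)
    newEnds = k₁ ∷ k₂ ∷ k₃ ∷ z ∷ []

    fresh : Disjoint (ends Y) newEnds
    fresh (x∈Y , here refl)                         = B-not-in-Y k₁∈B x∈Y
    fresh (x∈Y , there (here refl))                 = B-not-in-Y k₂∈B x∈Y
    fresh (x∈Y , there (there (here refl)))         = B-not-in-Y k₃∈B x∈Y
    fresh (x∈Y , there (there (there (here refl)))) = z∉Y x∈Y

    matchingM′ : IsMatching G (M′ z)
    matchingM′ =
      exchange Y B _ matchingM (clique k₁ k₂ k₁∈K k₂∈K k₁≢k₂ ∷ k₃z ∷ [])
        ((k₁≢k₂ ∷ k₁≢k₃ ∷ k₁≢z ∷ []) ∷ (k₂≢k₃ ∷ k₂≢z ∷ []) ∷ (k₃≢z ∷ []) ∷ [] ∷ [])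
        fresh

    matched-by-M′ : ∀ {x} → x ∈ ends Y ⊎ x ∈ newEnds → x ∈ ends (M′ z)
    matched-by-M′ = ∈-ends-++⁺ Y

    -- a K-vertex matched by M is matched by M′ z: only i₁, i₂, i₃ are freed
    matched-K-stays-matched : ∀ {x} → inK x ≡ true → x ∈ ends Y ⊎ x ∈ ends B → x ∈ ends (M′ z)
    matched-K-stays-matched x∈K (inj₁ x∈Y) = matched-by-M′ (inj₁ x∈Y)
    matched-K-stays-matched x∈K (inj₂ (here refl)) = matched-by-M′ (inj₂ (here refl))
    matched-K-stays-matched x∈K (inj₂ (there (here refl))) = ⊥-elim (K-disjoint-I x∈K i₁∈I)
    matched-K-stays-matched x∈K (inj₂ (there (there (here refl)))) =
      matched-by-M′ (inj₂ (there (here refl)))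
    matched-K-stays-matched x∈K (inj₂ (there (there (there (here refl))))) =
      ⊥-elim (K-disjoint-I x∈K i₂∈I)
    matched-K-stays-matched x∈K (inj₂ (there (there (there (there (here refl)))))) =
      matched-by-M′ (inj₂ (there (there (here refl))))
    matched-K-stays-matched x∈K (inj₂ (there (there (there (there (there (here refl))))))) =
      ⊥-elim (K-disjoint-I x∈K i₃∈I)

    unmatched-in-I : ∀ x → x ∉ ends (M′ z) → inK x ≡ false
    unmatched-in-I x x∉M′ with inK x in x∈K
    ... | false = refl
    ... | true with x ∈? ends M
    ...   | yes x∈M = ⊥-elim (x∉M′ (matched-K-stays-matched x∈K (∈-ends-++⁻ Y x∈M)))
    ...   | no x∉M with unmatched-K x x∈K x∉M
    ...     | refl = ⊥-elim (x∉M′ (matched-by-M′ (inj₂ (there (there (there (here refl)))))))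

    sizes : length Y + 3 ≡ length Y + 2
    sizes = trans (sym (length-++ Y))
              (trans (equimatchable M (M′ z) (dominating⇒maximal M matchingM dominatingM)
                        (dominating⇒maximal (M′ z) matchingM′
                          (unmatched-independent⇒dominating (λ x → inK x ≡ false)
                             independent (M′ z) unmatched-in-I)))
                     (length-++ Y))

    3≢2 : 3 ≢ 2
    3≢2 ()

  matched≢unmatched : ∀ {x u} → x ∈ ends M → u ∉ ends M → x ≢ u
  matched≢unmatched x∈M u∉M refl = u∉M x∈M

  -- M leaves at most one K-vertex unmatched, since K is a clique.
  unmatched-K-unique : ∀ {x u} → inK x ≡ true → inK u ≡ true → x ∉ ends M → u ∉ ends M → x ≡ u
  unmatched-K-unique {x} {u} x∈K u∈K x∉M u∉M with x ≟ u
  ... | yes x≡u = x≡u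
  ... | no x≢u = ⊥-elim (unmatched-nonadjacent M dominatingM x∉M u∉M (clique x u x∈K u∈K x≢u))

  -- Swap k₃ onto the unmatched K-vertex if there is one, and onto i₃ otherwise.
  contradiction : ⊥
  contradiction with any? (λ u → (inK u Bool.≟ true) ×-dec ¬? (u ∈? ends M))
  ... | yes (u , u∈K , u∉M) =
    swap-contradiction u (clique k₃ u k₃∈K u∈K (k≢u k₃∈B))
      (λ u∈Y → u∉M (∈-ends-++⁺ Y (inj₁ u∈Y))) (k≢u k₁∈B) (k≢u k₂∈B) (k≢u k₃∈B)
      (λ x x∈K x∉M → unmatched-K-unique x∈K u∈K x∉M u∉M)
    where
    k≢u : ∀ {k} → k ∈ ends B → k ≢ u
    k≢u k∈B = matched≢unmatched (B-matched k∈B) u∉M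
  ... | no allMatched =
    swap-contradiction i₃ k₃i₃ (B-not-in-Y i₃∈B)
      k₁≢i₃ k₂≢i₃ k₃≢i₃ (λ x x∈K x∉M → ⊥-elim (allMatched (x , x∈K , x∉M)))

lemma2p4 : ∀ {n : ℕ} (G : Graph n) (inK : Fin n → Bool) →
    NoIsolated G →
    IsSplitPartition G inK →
    (∀ k → inK k ≡ true → ∃ λ i → inK i ≡ false × Graph.Adj G k i) →
    Equimatchable G →
    ¬ (∃ λ (k₁ : Fin n) → ∃ λ (k₂ : Fin n) → ∃ λ (k₃ : Fin n) →
       ∃ λ (i₁ : Fin n) → ∃ λ (i₂ : Fin n) → ∃ λ (i₃ : Fin n) →
         Vec.Unique (k₁ ∷ k₂ ∷ k₃ ∷ i₁ ∷ i₂ ∷ i₃ ∷ []) ×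
         inK k₁ ≡ true × inK k₂ ≡ true × inK k₃ ≡ true ×
         inK i₁ ≡ false × inK i₂ ≡ false × inK i₃ ≡ false ×
         Graph.Adj G k₁ i₁ × Graph.Adj G k₂ i₂ × Graph.Adj G k₃ i₃)
lemma2p4 G inK _ (clique , independent) _ equimatchable
  (k₁ , k₂ , k₃ , i₁ , i₂ , i₃ , distinct , k₁∈K , k₂∈K , k₃∈K , i₁∈I , i₂∈I , i₃∈I ,
   k₁i₁ , k₂i₂ , k₃i₃) =
  Matchings.extend-to-dominating G B matchingB λ (Y , matchingM , dominatingM) →
    Swap.contradiction G inK clique independent equimatchable
      k₁∈K k₂∈K k₃∈K i₁∈I i₂∈I i₃∈I k₃i₃ Y matchingM dominatingM
  where
  B : List (Edge G)
  B = (k₁ , i₁) ∷ (k₂ , i₂) ∷ (k₃ , i₃) ∷ []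

  matchingB : IsMatching G B
  matchingB = k₁i₁ ∷ k₂i₂ ∷ k₃i₃ ∷ [] , interleave-unique distinct
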